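{- Let $M$ be a quadratic c-monoid. Then for every finite set $U$ and every $m\in M^{\underline k}[U]$, the interval $[\hat0,m]$ of $\mathcal P_M[U]$ is a graded poset of rank $k$.
   Context: Fix a field $\mathbb{K}$ of characteristic $0$. A set species is a functor from finite sets and bijections to finite sets; the product is $(M\cdot N)[U]=\biguplus_{U_1\uplus U_2=U}M[U_1]\times N[U_2]$. A set monoid is a set species $M$ with $M[\emptyset]$ a singleton $\{e\}$ and an associative natural $\nu:M\cdot M\to M$ with unit $e$. It is a c-monoid if it satisfies left cancellation: $\nu(m_1,m_2)=\nu(m_1,m_2')$ implies $m_2=m_2'$. On $\biguplus_{U_1\subseteq U}M[U_1]$ define $m_1\le_\nu m_2$ (with $m_i\in M[U_i]$) if $U_1\subseteq U_2$ and there is $m'\in M[U_2\setminus U_1]$ with $\nu(m_1,m')=m_2$; $\mathcal P_M[U]=\bigcup_{m\in M[U]}[\hat0,m]$, where $\hat 0=e$. A c-monoid $M$ is quadratic if its linearization $\mathbb K M$ (the tensor species with basis $M[U]$ and product extending $\nu$ linearly) is a quadratic monoid $\mathcal M(F,R)=\mathbb L(F)/\langle R\rangle$ (with $F[\emptyset]=0$, $R\subseteq F\cdot F$, $\langle R\rangle^{\underline k}=\sum_iF^iRF^{k-2-i}$) whose grading $M^{\underline k}=F^k/\langle R\rangle^{\underline k}$ is spanned by subsets of the basis; $M^{\underline k}[U]$ denotes the set of elements of $M[U]$ of degree $k$. A poset is graded if it has a least element $\hat0$ and greatest element $\hat1$ and all maximal chains in every interval have the same length; the rank is that length for the whole poset.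 -}

module Defs where

open import Level using (Level; _⊔_) renaming (suc to lsuc; zero to 0ℓ)
open import Data.Nat using (ℕ; zero; suc; _<_; _∸_) renaming (_+_ to _+ℕ_)
open import Data.Fin using (Fin)
open import Data.List using (List; []; _∷_; _++_; map; length; concatMap)
open import Data.List.Membership.Propositional using (_∈_)
open import Data.List.Relation.Unary.All using (All)
open import Data.List.Relation.Unary.Any using (Any)
open import Data.List.Relation.Unary.AllPairs using (AllPairs)
open import Data.List.Relation.Unary.Linked using (Linked)
open import Data.Product using (Σ; ∃; _×_; _,_; proj₁; proj₂)
open import Data.Sum using (_⊎_)
open import Data.Empty using (⊥)
open import Relation.Nullary using (¬_; yes; no)
open import Relation.Binary.PropositionalEquality using (_≡_; _≢_; refl; subst; sym; trans; cong)
open import Relation.Binary.Definitions using (DecidableEquality)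
open import Function.Bundles using (_↔_; _⇔_; Inverse)
open import Algebra.Bundles using (CommutativeRing)
import Data.List.Properties as LP
import Data.Product.Properties as PP
import Data.Fin.Properties as FP

record Field (c ℓ : Level) : Set (lsuc (c ⊔ ℓ)) where
  field
    commutativeRing : CommutativeRing c ℓ
  open CommutativeRing commutativeRing public
  field
    1≉0     : ¬ (1# ≈ 0#)
    inverse : ∀ x → ¬ (x ≈ 0#) → Σ Carrier (λ y → (x * y) ≈ 1#)

  natCast : ℕ → Carrier
  natCast zero    = 0#
  natCast (suc n) = 1# + natCast n

HasCharZero : ∀ {c ℓ} → Field c ℓ → Set ℓ
HasCharZero K = ∀ n → ¬ (natCast (suc n) ≈ 0#)
  where open Field K

-- The category of finite sets and bijections is replaced by
-- the equivalent full subcategory of finite subsets of ℕ, each represented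
-- canonically by its strictly increasing list of elements.

record FinSet : Set where
  constructor mkFinSet
  field
    elems     : List ℕ
    .sorted   : Linked _<_ elems
open FinSet public

∅ : FinSet
∅ = mkFinSet [] Linked.[]

infix 4 _∈ᵤ_
_∈ᵤ_ : ℕ → FinSet → Set
x ∈ᵤ U = x ∈ elems U

_≟FS_ : DecidableEquality FinSet
mkFinSet xs p ≟FS mkFinSet ys q with LP.≡-dec Data.Nat._≟_ xs ys
... | yes refl = yes refl
... | no ne    = no λ { refl → ne refl }

Finite : Set → Set
Finite A = Σ ℕ (λ n → A ↔ Fin n)

finite-decEq : ∀ {A} → Finite A → DecidableEquality A
finite-decEq (n , f) x y with Inverse.to f x FP.≟ Inverse.to f y
... | yes eq = yes (trans (sym (Inverse.strictlyInverseʳ f x))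
                   (trans (cong (Inverse.from f) eq) (Inverse.strictlyInverseʳ f y)))
... | no ne  = no λ { refl → ne refl }

record Bij (U V : FinSet) : Set where
  field
    fun  : ℕ → ℕ
    into : ∀ x → x ∈ᵤ U → fun x ∈ᵤ V
    inj  : ∀ x y → x ∈ᵤ U → y ∈ᵤ U → fun x ≡ fun y → x ≡ y
    surj : ∀ y → y ∈ᵤ V → Σ ℕ (λ x → x ∈ᵤ U × fun x ≡ y)
open Bij public

record Decomp (U₁ U₂ U : FinSet) : Set where
  field
    cover  : ∀ x → x ∈ᵤ U → x ∈ᵤ U₁ ⊎ x ∈ᵤ U₂
    incl₁  : ∀ x → x ∈ᵤ U₁ → x ∈ᵤ U
    incl₂  : ∀ x → x ∈ᵤ U₂ → x ∈ᵤ U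
    disj   : ∀ x → x ∈ᵤ U₁ → x ∈ᵤ U₂ → ⊥

record SetSpecies : Set₁ where
  field
    obj    : FinSet → Set
    finite : ∀ U → Finite (obj U)
    act    : ∀ {U V} → Bij U V → obj U → obj V
    act-id : ∀ {U} (f : Bij U U) → (∀ x → x ∈ᵤ U → fun f x ≡ x) →
             ∀ m → act f m ≡ m
    act-∘  : ∀ {U V W} (f : Bij U V) (g : Bij V W) (h : Bij U W) →
             (∀ x → x ∈ᵤ U → fun h x ≡ fun g (fun f x)) →
             ∀ m → act h m ≡ act g (act f m)

record SetMonoid : Set₁ where
  field
    species : SetSpecies
  open SetSpecies species public
  field
    e        : obj ∅
    e-unique : ∀ (m : obj ∅) → m ≡ e
    ν        : ∀ {U₁ U₂ U} → Decomp U₁ U₂ U → obj U₁ → obj U₂ → obj U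
    unitˡ    : ∀ {U} (d : Decomp ∅ U U) (m : obj U) → ν d e m ≡ m
    unitʳ    : ∀ {U} (d : Decomp U ∅ U) (m : obj U) → ν d m e ≡ m
    assoc    : ∀ {U₁ U₂ U₃ U₁₂ U₂₃ U}
               (d₁₂ : Decomp U₁ U₂ U₁₂) (d : Decomp U₁₂ U₃ U)
               (d₂₃ : Decomp U₂ U₃ U₂₃) (d′ : Decomp U₁ U₂₃ U)
               (a : obj U₁) (b : obj U₂) (c : obj U₃) →
               ν d (ν d₁₂ a b) c ≡ ν d′ a (ν d₂₃ b c)
    natural  : ∀ {U₁ U₂ U V₁ V₂ V}
               (d : Decomp U₁ U₂ U) (d′ : Decomp V₁ V₂ V)
               (σ : Bij U V) (τ₁ : Bij U₁ V₁) (τ₂ : Bij U₂ V₂) →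
               (∀ x → x ∈ᵤ U₁ → fun τ₁ x ≡ fun σ x) →
               (∀ x → x ∈ᵤ U₂ → fun τ₂ x ≡ fun σ x) →
               ∀ (m₁ : obj U₁) (m₂ : obj U₂) → act σ (ν d m₁ m₂) ≡ ν d′ (act τ₁ m₁) (act τ₂ m₂)

record CMonoid : Set₁ where
  field
    setMonoid : SetMonoid
  open SetMonoid setMonoid public
  field
    cancelˡ : ∀ {U₁ U₂ U} (d : Decomp U₁ U₂ U) (m₁ : obj U₁) (m₂ m₂′ : obj U₂) →
              ν d m₁ m₂ ≡ ν d m₁ m₂′ → m₂ ≡ m₂′

module Order (M : CMonoid) where
  open CMonoid M

  Elt : Set
  Elt = Σ FinSet obj

  _≤ν_ : Elt → Elt → Set
  (U₁ , m₁) ≤ν (U₂ , m₂) =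
    Σ FinSet λ W → Σ (Decomp U₁ W U₂) λ d → Σ (obj W) λ m′ → ν d m₁ m′ ≡ m₂

  0̂ : Elt
  0̂ = ∅ , e

  InInterval : (U : FinSet) → obj U → Elt → Set
  InInterval U m x = (0̂ ≤ν x) × (x ≤ν (U , m))

module GradedPoset {A : Set} (_≤_ : A → A → Set) (S : A → Set) where

  _<ₚ_ : A → A → Set
  x <ₚ y = (x ≤ y) × (x ≢ y)

  IsChain : A → A → List A → Set
  IsChain x y C = Linked _<ₚ_ C × All (λ z → S z × (x ≤ z) × (z ≤ y)) C

  IsMaximalChain : A → A → List A → Set
  IsMaximalChain x y C =
    IsChain x y C ×
    (∀ C′ → IsChain x y C′ → (∀ z → z ∈ C → z ∈ C′) → ∀ z → z ∈ C′ → z ∈ C)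

  chainLength : List A → ℕ
  chainLength C = length C ∸ 1

  record IsGradedOfRank (r : ℕ) : Set where
    field
      refl′   : ∀ x → S x → x ≤ x
      trans′  : ∀ x y z → S x → S y → S z → x ≤ y → y ≤ z → x ≤ z
      antisym : ∀ x y → S x → S y → x ≤ y → y ≤ x → x ≡ y
      bot     : A
      bot∈S   : S bot
      bot-min : ∀ x → S x → bot ≤ x
      top     : A
      top∈S   : S top
      top-max : ∀ x → S x → x ≤ top
      graded  : ∀ x y → S x → S y → ∀ C C′ →
                IsMaximalChain x y C → IsMaximalChain x y C′ →
                chainLength C ≡ chainLength C′
      rank    : Σ (List A) λ C → IsMaximalChain bot top C × chainLength C ≡ r

-- Quadratic c-monoids.  Elements of L(F)^k[U] are finite formal K-linear
-- combinations of words a₁ ⋯ a_k of elements of A on blocks U₁,…,U_k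
-- forming an ordered decomposition of U.

module Quadratic {c ℓ : Level} (K : Field c ℓ) (M : CMonoid) where
  open Field K using (Carrier; _≈_; _+_; _*_; 0#)
  open CMonoid M

  Word : Set
  Word = List (Σ FinSet obj)

  decEqElt : DecidableEquality (Σ FinSet obj)
  decEqElt = PP.≡-dec _≟FS_ (λ {U} → finite-decEq (finite U))

  decEqWord : DecidableEquality Word
  decEqWord = LP.≡-dec decEqElt

  -- finite formal linear combinations over a basis X with decidable equality
  FS : Set → Set c
  FS X = List (Carrier × X)

  coeff : ∀ {X : Set} → DecidableEquality X → FS X → X → Carrier
  coeff eq [] x = 0#
  coeff eq ((a , y) ∷ v) x with eq y x
  ... | yes _ = a + coeff eq v x
  ... | no  _ = coeff eq v x

  data Prod : Word → (U : FinSet) → obj U → Set where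
    prod-[] : Prod [] ∅ e
    prod-∷  : ∀ {V W U a w m′} (d : Decomp V W U) →
              Prod w W m′ → Prod ((V , a) ∷ w) U (ν d a m′)

  Partition : List FinSet → FinSet → Set
  Partition Us U =
    (∀ x → (x ∈ᵤ U) ⇔ Any (x ∈ᵤ_) Us) ×
    AllPairs (λ V W → ∀ x → x ∈ᵤ V → x ∈ᵤ W → ⊥) Us

  blocks : Word → List FinSet
  blocks = map proj₁

  module Presentation (IsAtom : ∀ {V} → obj V → Set) where

    Atoms : Word → Set
    Atoms = All (λ p → IsAtom (proj₂ p))

    -- a basis element of L(F)^k[U] with a coefficient, together with
    -- its image under φ : L(F) → 𝕂M
    record Term (U : FinSet) (k : ℕ) : Set c where
      field
        coef  : Carrier
        word  : Word
        atoms : Atoms word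
        len   : length word ≡ k
        val   : obj U
        prod  : Prod word U val

    forget : ∀ {U k} → List (Term U k) → FS Word
    forget = map λ t → Term.coef t , Term.word t

    image : ∀ {U k} → List (Term U k) → FS (obj U)
    image = map λ t → Term.coef t , Term.val t

    InKernel : ∀ {U k} → List (Term U k) → Set ℓ
    InKernel {U} v = ∀ m → coeff (finite-decEq (finite U)) (image v) m ≈ 0#

    -- generators u · r · w of the ideal ⟨R⟩, R = ker(φ) ∩ F·F
    record Gen (U : FinSet) (k : ℕ) : Set (c ⊔ ℓ) where
      field
        coef     : Carrier
        U₁ V W   : FinSet
        part     : Partition (U₁ ∷ V ∷ W ∷ []) U
        u w      : Word
        u-atoms  : Atoms u
        w-atoms  : Atoms w
        u-part   : Partition (blocks u) U₁
        w-part   : Partition (blocks w) W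
        r        : List (Term V 2)
        r∈R      : InKernel r
        len      : length u +ℕ 2 +ℕ length w ≡ k

    expand : ∀ {U k} → Gen U k → FS Word
    expand g = map (λ t → (coef * Term.coef t) , (u ++ Term.word t ++ w)) r
      where open Gen g

    HasDegree : ∀ {U} → obj U → ℕ → Set
    HasDegree {U} m k = Σ Word λ w → Atoms w × length w ≡ k × Prod w U m

  record QuadraticStructure : Set (lsuc 0ℓ ⊔ c ⊔ ℓ) where
    field
      -- the subspecies A ⊆ M with F ≅ 𝕂·A
      IsAtom        : ∀ {V} → obj V → Set
      atom-natural  : ∀ {V W} (f : Bij V W) m → IsAtom m → IsAtom (act f m)
      atom-nonempty : ∀ (m : obj ∅) → IsAtom m → ⊥
      -- φ : L(F) → 𝕂M is surjective
      generated : ∀ U (m : obj U) →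
                  Σ Word λ w → Presentation.Atoms IsAtom w × Prod w U m
      -- 𝕂M = ⊕_k M^k, with M^k spanned by the products of k-words
      graded    : ∀ {U} (m : obj U) w w′ →
                  Presentation.Atoms IsAtom w → Presentation.Atoms IsAtom w′ →
                  Prod w U m → Prod w′ U m → length w ≡ length w′
      -- ker φ ⊆ ⟨R⟩ degreewise, with R = ker φ ∩ F·F
      quadratic : ∀ U k (v : List (Presentation.Term IsAtom U k)) →
                  Presentation.InKernel IsAtom v →
                  Σ (List (Presentation.Gen IsAtom U k)) λ gs →
                    ∀ x → coeff decEqWord (Presentation.forget IsAtom v) x ≈
                          coeff decEqWord
                            (concatMap (Presentation.expand IsAtom) gs) x
    open Presentation IsAtom public

record QuadraticCMonoid {c ℓ : Level} (K : Field c ℓ) : Set (lsuc 0ℓ ⊔ c ⊔ ℓ) where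
  field
    cmonoid   : CMonoid
    structure : Quadratic.QuadraticStructure K cmonoid

module Submission where

-- In a quadratic c-monoid every element m ∈ M[U] is a product of a
-- word of atoms, and all such words have the same length deg m.  Hence the
-- degree is additive along ν, so along x ≤ν y = ν(x, q) it is monotone, it
-- only stays constant when q is the unit (so x = y), and when it jumps we can
-- peel off the first atom of q to get an element of degree deg x + 1 between
-- x and y.  These are exactly the axioms of a "ranked preorder", and in any
-- ranked preorder the maximal chains of an interval [x , y] are the chains
-- whose ranks run through deg x, deg x + 1, …, deg y without gaps; so they all
-- have length deg y - deg x, and one such chain exists.

open import Defs
open import Level using (Level)
open import Data.Nat using (ℕ; zero; suc; _<_; _≤_; _+_; _∸_; _<?_; s≤s; z≤n)
open import Data.Nat.Properties
  using (≤-refl; <⇒≤; <-trans; <-irrefl; ≤-antisym; ≤∧≢⇒<; <⇒≱; <-≤-trans;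
         m≤n⇒m<n∨m≡n; m≤m+n; m≤n+m; m∸n+n≡m; +-suc; +-comm; +-identityʳ; +-cancelˡ-≡)
open import Data.List using (List; []; _∷_; _++_; filter; length)
open import Data.List.Properties using (length-++)
open import Data.List.Relation.Unary.Any using (here; there)
open import Data.List.Relation.Unary.All as All using (All; []; _∷_)
open import Data.List.Relation.Unary.All.Properties using (++⁺)
open import Data.List.Relation.Unary.AllPairs as AllPairs using ([]; _∷_)
open import Data.List.Relation.Unary.Linked as Linked using (Linked; []; [-]; _∷_; linked?)
open import Data.List.Relation.Unary.Linked.Properties using (Linked⇒AllPairs; filter⁺)
open import Data.List.Membership.Propositional using (_∈_)
open import Data.List.Membership.Propositional.Properties using (∈-filter⁺; ∈-filter⁻)
open import Data.List.Membership.DecPropositional Data.Nat._≟_ using (_∈?_)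
open import Data.Product using (Σ; _×_; _,_; proj₁; proj₂)
open import Data.Sum using (_⊎_; inj₁; inj₂)
open import Data.Empty using (⊥; ⊥-elim; ⊥-elim-irr)
open import Relation.Binary.Definitions using (Transitive)
open import Relation.Nullary using (yes; no; Dec)
open import Relation.Nullary.Decidable using (_⊎-dec_)
open import Relation.Binary.PropositionalEquality using (_≡_; _≢_; refl; sym; trans; cong; subst)

linked-head : ∀ {A : Set} {R : A → A → Set} → Transitive R →
              ∀ {x xs z} → Linked R (x ∷ xs) → z ∈ xs → R x z
linked-head R-trans l z∈xs = All.lookup (AllPairs.head (Linked⇒AllPairs R-trans l)) z∈xs

least-member : ∀ {y ys z} → Linked _<_ (y ∷ ys) → z ∈ y ∷ ys → y ≤ z
least-member _ (here refl) = ≤-refl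
least-member l (there p)   = <⇒≤ (linked-head <-trans l p)

drop-head : ∀ {A : Set} {y z : A} {ys} → z ∈ y ∷ ys → y ≢ z → z ∈ ys
drop-head (here refl) y≢z = ⊥-elim (y≢z refl)
drop-head (there p)   _   = p

sorted-ext : ∀ {xs ys} → Linked _<_ xs → Linked _<_ ys →
             (∀ z → z ∈ xs → z ∈ ys) → (∀ z → z ∈ ys → z ∈ xs) → xs ≡ ys
sorted-ext {[]}    {[]}    _ _ _ _ = refl
sorted-ext {[]}    {y ∷ _} _ _ _ ys⊆ with ys⊆ y (here refl)
... | ()
sorted-ext {x ∷ _} {[]}    _ _ xs⊆ _ with xs⊆ x (here refl)
... | ()
sorted-ext {x ∷ xs} {y ∷ ys} lx ly xs⊆ ys⊆
  with ≤-antisym (least-member ly (xs⊆ x (here refl))) (least-member lx (ys⊆ y (here refl)))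
... | refl = cong (y ∷_) (sorted-ext (Linked.tail lx) (Linked.tail ly) tail⊆ tail⊇)
  where
  tail⊆ : ∀ z → z ∈ xs → z ∈ ys
  tail⊆ z p = drop-head (xs⊆ z (there p)) (λ { refl → <-irrefl refl (linked-head <-trans lx p) })
  tail⊇ : ∀ z → z ∈ ys → z ∈ xs
  tail⊇ z p = drop-head (ys⊆ z (there p)) (λ { refl → <-irrefl refl (linked-head <-trans ly p) })

-- The irrelevant sortedness proof of a finite set can be recomputed, since
-- being strictly increasing is decidable.
linked-elems : (U : FinSet) → Linked _<_ (elems U)
linked-elems (mkFinSet xs p) with linked? _<?_ xs
... | yes q = q
... | no ¬q = ⊥-elim-irr (¬q p)

finset-ext : ∀ {U V : FinSet} → (∀ x → x ∈ᵤ U → x ∈ᵤ V) → (∀ x → x ∈ᵤ V → x ∈ᵤ U) → U ≡ V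
finset-ext {U@(mkFinSet _ _)} {V@(mkFinSet _ _)} U⊆V V⊆U
  with sorted-ext (linked-elems U) (linked-elems V) U⊆V V⊆U
... | refl = refl

in-either? : (A B : FinSet) (x : ℕ) → Dec (x ∈ᵤ A ⊎ x ∈ᵤ B)
in-either? A B x = (x ∈? elems A) ⊎-dec (x ∈? elems B)

union : (T A B : FinSet) → FinSet
union T A B = mkFinSet (filter (in-either? A B) (elems T)) (filter⁺ (in-either? A B) <-trans (linked-elems T))

union⁺ : ∀ T A B {x} → x ∈ᵤ T → x ∈ᵤ A ⊎ x ∈ᵤ B → x ∈ᵤ union T A B
union⁺ _ A B = ∈-filter⁺ (in-either? A B)

union⁻ : ∀ T A B {x} → x ∈ᵤ union T A B → x ∈ᵤ T × (x ∈ᵤ A ⊎ x ∈ᵤ B)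
union⁻ _ A B = ∈-filter⁻ (in-either? A B)

decomp-swap : ∀ {A B T} → Decomp A B T → Decomp B A T
decomp-swap d = record
  { cover = λ x p → swap (cover x p) ; incl₁ = incl₂ ; incl₂ = incl₁ ; disj = λ x p q → disj x q p }
  where
  open Decomp d
  swap : ∀ {P Q : Set} → P ⊎ Q → Q ⊎ P
  swap (inj₁ p) = inj₂ p
  swap (inj₂ q) = inj₁ q

decomp-unit : ∀ {U} → Decomp U ∅ U
decomp-unit = record { cover = λ x p → inj₁ p ; incl₁ = λ x p → p ; incl₂ = λ x () ; disj = λ x _ () }

decomp-∅ʳ : ∀ {A T} → Decomp A ∅ T → A ≡ T
decomp-∅ʳ {A} {T} d = finset-ext (Decomp.incl₁ d) (λ x p → onlyA (Decomp.cover d x p))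
  where
  onlyA : ∀ {x} → x ∈ᵤ A ⊎ x ∈ᵤ ∅ → x ∈ᵤ A
  onlyA (inj₁ p) = p

decomp-∅ˡ : ∀ {B T} → Decomp ∅ B T → B ≡ T
decomp-∅ˡ d = decomp-∅ʳ (decomp-swap d)

reassocʳ : ∀ {A B AB C T} → Decomp A B AB → Decomp AB C T →
           Σ FinSet λ BC → Decomp B C BC × Decomp A BC T
reassocʳ {A} {B} {AB} {C} {T} d₁ d₂ = union T B C , dBC , dT
  where
  module d₁ = Decomp d₁
  module d₂ = Decomp d₂
  dBC : Decomp B C (union T B C)
  dBC = record
    { cover = λ x p → proj₂ (union⁻ T B C p)
    ; incl₁ = λ x p → union⁺ T B C (d₂.incl₁ x (d₁.incl₂ x p)) (inj₁ p)
    ; incl₂ = λ x p → union⁺ T B C (d₂.incl₂ x p) (inj₂ p)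
    ; disj  = λ x p q → d₂.disj x (d₁.incl₂ x p) q }
  cover : ∀ x → x ∈ᵤ T → x ∈ᵤ AB ⊎ x ∈ᵤ C → x ∈ᵤ A ⊎ x ∈ᵤ union T B C
  cover x t (inj₁ p) with d₁.cover x p
  ... | inj₁ a = inj₁ a
  ... | inj₂ b = inj₂ (union⁺ T B C t (inj₁ b))
  cover x t (inj₂ c) = inj₂ (union⁺ T B C t (inj₂ c))
  disj : ∀ x → x ∈ᵤ A → x ∈ᵤ B ⊎ x ∈ᵤ C → ⊥
  disj x a (inj₁ b) = d₁.disj x a b
  disj x a (inj₂ c) = d₂.disj x (d₁.incl₁ x a) c
  dT : Decomp A (union T B C) T
  dT = record
    { cover = λ x p → cover x p (d₂.cover x p)
    ; incl₁ = λ x p → d₂.incl₁ x (d₁.incl₁ x p)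
    ; incl₂ = λ x p → proj₁ (union⁻ T B C p)
    ; disj  = λ x p q → disj x p (proj₂ (union⁻ T B C q)) }

reassocˡ : ∀ {A B C BC T} → Decomp B C BC → Decomp A BC T →
           Σ FinSet λ AB → Decomp A B AB × Decomp AB C T
reassocˡ d₁ d₂ with reassocʳ (decomp-swap d₁) (decomp-swap d₂)
... | BA , dCB , dT = BA , decomp-swap dCB , decomp-swap dT

module RankedPreorder {A : Set} (_≼_ : A → A → Set) (rk : A → ℕ)
  (≼-refl  : ∀ x → x ≼ x)
  (≼-trans : ∀ {x y z} → x ≼ y → y ≼ z → x ≼ z)
  (rk-mono     : ∀ {x y} → x ≼ y → rk x ≤ rk y)
  (rk-injective : ∀ {x y} → x ≼ y → rk x ≡ rk y → x ≡ y)
  (rk-step     : ∀ {x y} → x ≼ y → rk x < rk y →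
                 Σ A λ z → x ≼ z × z ≼ y × rk z ≡ suc (rk x))
  (bot top : A)
  where

  InBounds : A → Set
  InBounds z = (bot ≼ z) × (z ≼ top)

  open GradedPoset _≼_ InBounds

  Between : A → A → A → Set
  Between x y z = InBounds z × (x ≼ z) × (z ≼ y)

  <ₚ⇒rk< : ∀ {x y} → x <ₚ y → rk x < rk y
  <ₚ⇒rk< (x≼y , x≢y) = ≤∧≢⇒< (rk-mono x≼y) (λ eq → x≢y (rk-injective x≼y eq))

  rk<⇒<ₚ : ∀ {x y} → x ≼ y → rk x < rk y → x <ₚ y
  rk<⇒<ₚ x≼y lt = x≼y , λ { refl → <-irrefl refl lt }

  <ₚ-trans : Transitive _<ₚ_
  <ₚ-trans (x≼y , x≢y) y<z = rk<⇒<ₚ (≼-trans x≼y (proj₁ y<z)) (<-trans (<ₚ⇒rk< (x≼y , x≢y)) (<ₚ⇒rk< y<z))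

  head-least : ∀ {c rest z} → Linked _<ₚ_ (c ∷ rest) → z ∈ c ∷ rest → rk c ≤ rk z
  head-least _ (here refl) = ≤-refl
  head-least l (there p)   = <⇒≤ (<ₚ⇒rk< (linked-head <ₚ-trans l p))

  rk-injective-on-chain : ∀ {C a b} → Linked _<ₚ_ C → a ∈ C → b ∈ C → rk a ≡ rk b → a ≡ b
  rk-injective-on-chain l (here refl) (here refl) _ = refl
  rk-injective-on-chain l (here refl) (there q) eq = ⊥-elim (<-irrefl eq (<ₚ⇒rk< (linked-head <ₚ-trans l q)))
  rk-injective-on-chain l (there p) (here refl) eq = ⊥-elim (<-irrefl (sym eq) (<ₚ⇒rk< (linked-head <ₚ-trans l p)))
  rk-injective-on-chain l (there p) (there q) eq = rk-injective-on-chain (Linked.tail l) p q eq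

  rebase : ∀ {x y c rest} → IsChain x y (c ∷ rest) → IsChain c y (c ∷ rest)
  rebase (l , (sc , _ , cy) ∷ inside) =
    l , (sc , ≼-refl _ , cy) ∷ All.zipWith (λ { (c<z , sz , _ , zy) → sz , proj₁ c<z , zy })
                                             (All.tabulate (linked-head <ₚ-trans l) , inside)

  prepend : ∀ {x y a b C} → Between x y a → a <ₚ b → IsChain b y C → IsChain x y (a ∷ C)
  prepend {C = []}    ia a<b _ = [-] , ia ∷ []
  prepend {C = _ ∷ _} ia@(_ , xa , _) a<b (l , inside@((_ , b≼h , _) ∷ _)) =
    rk<⇒<ₚ (≼-trans (proj₁ a<b) b≼h) (<-≤-trans (<ₚ⇒rk< a<b) (rk-mono b≼h)) ∷ l ,
    ia ∷ All.map (λ { (sz , bz , zy) → sz , ≼-trans xa (≼-trans (proj₁ a<b) bz) , zy }) inside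

  <-of-successor : ∀ {a b} → rk b ≡ suc (rk a) → rk a < rk b
  <-of-successor eq = subst (rk _ <_) (sym eq) ≤-refl

  data Saturated : ℕ → ℕ → List A → Set where
    one  : ∀ {d} c → rk c ≡ d → Saturated d d (c ∷ [])
    cons : ∀ {d e} c {rest} → rk c ≡ d → Saturated (suc d) e rest → Saturated d e (c ∷ rest)

  saturated-length : ∀ {d e C} → Saturated d e C → d + chainLength C ≡ e
  saturated-length {d} (one _ _) = +-identityʳ d
  saturated-length {d} (cons _ {_ ∷ rest} _ s) = trans (+-suc d (length rest)) (saturated-length s)

  saturated-hits : ∀ {d e C} → Saturated d e C → ∀ n → d ≤ n → n ≤ e →
                   Σ A λ c → c ∈ C × rk c ≡ n
  saturated-hits (one c rc) n d≤n n≤e = c , here refl , trans rc (≤-antisym d≤n n≤e)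
  saturated-hits (cons c rc s) n d≤n n≤e with m≤n⇒m<n∨m≡n d≤n
  ... | inj₂ d≡n = c , here refl , trans rc d≡n
  ... | inj₁ d<n with saturated-hits s n d<n n≤e
  ...   | c′ , c′∈ , rc′ = c′ , there c′∈ , rc′

  -- A saturated chain cannot be refined: any chain containing it has its
  -- ranks in the same range, and each rank is already taken.
  saturated⇒maximal : ∀ {x y C} → IsChain x y C → Saturated (rk x) (rk y) C → IsMaximalChain x y C
  saturated⇒maximal {x} {y} {C} ch s = ch , absorbed
    where
    absorbed : ∀ C′ → IsChain x y C′ → (∀ z → z ∈ C → z ∈ C′) → ∀ z → z ∈ C′ → z ∈ C
    absorbed C′ (l′ , inside′) C⊆C′ z z∈C′ with All.lookup inside′ z∈C′
    ... | _ , xz , zy with saturated-hits s (rk z) (rk-mono xz) (rk-mono zy)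
    ...   | c , c∈C , rc with rk-injective-on-chain l′ (C⊆C′ c c∈C) z∈C′ rc
    ...     | refl = c∈C

  -- Conversely, a maximal chain of [x , y] is saturated: its head has rank
  -- rk x (else prepend x), its last element has rank rk y (else append y),
  -- consecutive ranks differ by one (else insert a rank-step between them),
  -- and its tail is a maximal chain of the smaller interval.
  maximal-nonempty : ∀ {x y} → InBounds x → x ≼ y → IsMaximalChain x y [] → ⊥
  maximal-nonempty {x} sx xy (_ , maximal)
    with maximal (x ∷ []) ([-] , (sx , ≼-refl x , xy) ∷ []) (λ _ ()) x (here refl)
  ... | ()

  maximal-head : ∀ {x y c rest} → InBounds x → x ≼ y → IsMaximalChain x y (c ∷ rest) → rk c ≡ rk x
  maximal-head {x} {y} {c} {rest} sx xy (ch@(l , (_ , xc , _) ∷ _) , maximal)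
    with m≤n⇒m<n∨m≡n (rk-mono xc)
  ... | inj₂ eq = sym eq
  ... | inj₁ lt = ⊥-elim (<⇒≱ lt (head-least l (maximal (x ∷ c ∷ rest) longer (λ _ → there) x (here refl))))
    where
    longer : IsChain x y (x ∷ c ∷ rest)
    longer = prepend (sx , ≼-refl x , xy) (rk<⇒<ₚ xc lt) (rebase ch)

  maximal-last : ∀ {x y c} → InBounds y → IsMaximalChain x y (c ∷ []) → rk c ≡ rk y
  maximal-last {x} {y} {c} sy (([-] , ic@(_ , _ , cy) ∷ []) , maximal) with m≤n⇒m<n∨m≡n (rk-mono cy)
  ... | inj₂ eq = eq
  ... | inj₁ lt
    with maximal (c ∷ y ∷ []) (prepend ic (rk<⇒<ₚ cy lt) ([-] , (sy , ≼-refl y , ≼-refl y) ∷ []))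
                 (λ { _ (here e) → here e }) y (there (here refl))
  ...   | here y≡c = ⊥-elim (<-irrefl (cong rk (sym y≡c)) lt)

  maximal-covers : ∀ {x y c c₁ rest} → IsMaximalChain x y (c ∷ c₁ ∷ rest) → rk c₁ ≡ suc (rk c)
  maximal-covers {x} {y} {c} {c₁} {rest} ((c<c₁ ∷ l , ic@(sc , _ , _) ∷ ic₁@(sc₁ , _ , c₁y) ∷ inside) , maximal)
    with m≤n⇒m<n∨m≡n (<ₚ⇒rk< c<c₁)
  ... | inj₂ eq = sym eq
  ... | inj₁ lt with rk-step (proj₁ c<c₁) (<ₚ⇒rk< c<c₁)
  ...   | z , cz , zc₁ , rz = ⊥-elim (gap (maximal (c ∷ z ∷ c₁ ∷ rest) refined included z (there (here refl))))
    where
    c<z : rk c < rk z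
    c<z = <-of-successor rz
    z<c₁ : rk z < rk c₁
    z<c₁ = subst (_< rk c₁) (sym rz) lt
    sz : InBounds z
    sz = ≼-trans (proj₁ sc) cz , ≼-trans zc₁ (proj₂ sc₁)
    refined : IsChain x y (c ∷ z ∷ c₁ ∷ rest)
    refined = prepend ic (rk<⇒<ₚ cz c<z)
                (prepend (sz , ≼-refl z , ≼-trans zc₁ c₁y) (rk<⇒<ₚ zc₁ z<c₁) (rebase (l , ic₁ ∷ inside)))
    included : ∀ w → w ∈ c ∷ c₁ ∷ rest → w ∈ c ∷ z ∷ c₁ ∷ rest
    included _ (here e) = here e
    included _ (there p) = there (there p)
    gap : z ∈ c ∷ c₁ ∷ rest → ⊥
    gap (here z≡c) = <-irrefl (cong rk (sym z≡c)) c<z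
    gap (there p) = <⇒≱ z<c₁ (head-least l p)

  maximal-tail : ∀ {x y c c₁ rest} → IsMaximalChain x y (c ∷ c₁ ∷ rest) → IsMaximalChain c₁ y (c₁ ∷ rest)
  maximal-tail {x} {y} {c} {c₁} {rest} ((c<c₁ ∷ l , ic ∷ ic₁ ∷ inside) , maximal) =
    rebase (l , ic₁ ∷ inside) , absorbed
    where
    absorbed : ∀ C′ → IsChain c₁ y C′ → (∀ z → z ∈ c₁ ∷ rest → z ∈ C′) → ∀ z → z ∈ C′ → z ∈ c₁ ∷ rest
    absorbed C′ ch′ ⊆C′ z z∈C′
      with maximal (c ∷ C′) (prepend ic c<c₁ ch′) (λ { _ (here e) → here e ; w (there p) → there (⊆C′ w p) })
                   z (there z∈C′)
    ... | there p = p
    ... | here refl = ⊥-elim (<⇒≱ (<ₚ⇒rk< c<c₁) (rk-mono (proj₁ (proj₂ (All.lookup (proj₂ ch′) z∈C′)))))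

  maximal⇒saturated : ∀ {x y} → InBounds x → InBounds y → x ≼ y →
                      ∀ C → IsMaximalChain x y C → Saturated (rk x) (rk y) C
  maximal⇒saturated sx sy xy [] m = ⊥-elim (maximal-nonempty sx xy m)
  maximal⇒saturated {x} {y} sx sy xy (c ∷ []) m =
    subst (λ e → Saturated (rk x) e (c ∷ [])) (trans (sym (maximal-head sx xy m)) (maximal-last sy m))
          (one c (maximal-head sx xy m))
  maximal⇒saturated {x} {y} sx sy xy (c ∷ c₁ ∷ rest) m@((_ , _ ∷ (sc₁ , _ , c₁y) ∷ _) , _) =
    cons c (maximal-head sx xy m)
      (subst (λ d → Saturated d (rk y) (c₁ ∷ rest)) rk-c₁
             (maximal⇒saturated sc₁ sy c₁y (c₁ ∷ rest) (maximal-tail m)))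
    where
    rk-c₁ : rk c₁ ≡ suc (rk x)
    rk-c₁ = trans (maximal-covers m) (cong suc (maximal-head sx xy m))

  maximal-length : ∀ {x y} → InBounds x → InBounds y → x ≼ y →
                   ∀ C → IsMaximalChain x y C → rk x + chainLength C ≡ rk y
  maximal-length sx sy xy C m = saturated-length (maximal⇒saturated sx sy xy C m)

  climb : ∀ n {x y} → InBounds x → InBounds y → x ≼ y → n + rk x ≡ rk y →
          Σ (List A) λ C → IsChain x y C × Saturated (rk x) (rk y) C
  climb zero {x} sx sy xy gap with rk-injective xy gap
  ... | refl = x ∷ [] , ([-] , (sx , ≼-refl x , xy) ∷ []) , one x refl
  climb (suc n) {x} {y} sx sy xy gap with rk-step xy (subst (rk x <_) gap (s≤s (m≤n+m (rk x) n)))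
  ... | z , xz , zy , rz with climb n (≼-trans (proj₁ sx) xz , ≼-trans zy (proj₂ sy)) sy zy
                                    (trans (cong (n +_) rz) (trans (+-suc n (rk x)) gap))
  ...   | C , ch , s = x ∷ C , prepend (sx , ≼-refl x , xy) (rk<⇒<ₚ xz (<-of-successor rz)) ch ,
                       cons x refl (subst (λ d → Saturated d (rk y) C) rz s)

  maximal-chain-exists : ∀ {x y} → InBounds x → InBounds y → x ≼ y → Σ (List A) (IsMaximalChain x y)
  maximal-chain-exists {x} {y} sx sy xy with climb (rk y ∸ rk x) sx sy xy (m∸n+n≡m (rk-mono xy))
  ... | C , ch , s = C , saturated⇒maximal ch s

  ends-ordered : ∀ {x y c C} → IsChain x y (c ∷ C) → x ≼ y
  ends-ordered (_ , (_ , xc , cy) ∷ _) = ≼-trans xc cy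

  interval-graded : bot ≼ top → ∀ r → rk bot + r ≡ rk top → IsGradedOfRank r
  interval-graded bot≼top r gap = record
    { refl′   = λ x _ → ≼-refl x
    ; trans′  = λ _ _ _ _ _ _ → ≼-trans
    ; antisym = λ _ _ _ _ xy yx → rk-injective xy (≤-antisym (rk-mono xy) (rk-mono yx))
    ; bot     = bot
    ; bot∈S   = bot-in
    ; bot-min = λ _ → proj₁
    ; top     = top
    ; top∈S   = top-in
    ; top-max = λ _ → proj₂
    ; graded  = graded
    ; rank    = rank
    }
    where
    same-length : ∀ {x y} → InBounds x → InBounds y → x ≼ y → ∀ C C′ →
                  IsMaximalChain x y C → IsMaximalChain x y C′ → chainLength C ≡ chainLength C′
    same-length {x} sx sy xy C C′ m m′ =
      +-cancelˡ-≡ (rk x) _ _ (trans (maximal-length sx sy xy C m) (sym (maximal-length sx sy xy C′ m′)))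
    graded : ∀ x y → InBounds x → InBounds y → ∀ C C′ → IsMaximalChain x y C → IsMaximalChain x y C′ →
             chainLength C ≡ chainLength C′
    graded x y sx sy []        []         _ _  = refl
    graded x y sx sy C@(_ ∷ _) C′         m m′ = same-length sx sy (ends-ordered (proj₁ m)) C C′ m m′
    graded x y sx sy []        C′@(_ ∷ _) m m′ = same-length sx sy (ends-ordered (proj₁ m′)) [] C′ m m′
    bot-in : InBounds bot
    bot-in = ≼-refl bot , bot≼top
    top-in : InBounds top
    top-in = bot≼top , ≼-refl top
    rank : Σ (List A) λ C → IsMaximalChain bot top C × chainLength C ≡ r
    rank with maximal-chain-exists bot-in top-in bot≼top
    ... | C , m = C , m , +-cancelˡ-≡ (rk bot) _ _ (trans (maximal-length bot-in top-in bot≼top C m) (sym gap))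

module Degree {c ℓ : Level} (K : Field c ℓ) (M : CMonoid) (St : Quadratic.QuadraticStructure K M) where
  open CMonoid M
  open Quadratic.QuadraticStructure St
  open Quadratic K M using (Prod; prod-[]; prod-∷)
  open Order M

  deg : Elt → ℕ
  deg (U , m) = length (proj₁ (generated U m))

  deg-word : ∀ {U m w} → Atoms w → Prod w U m → deg (U , m) ≡ length w
  deg-word {U} {m} {w} atoms p with generated U m
  ... | w′ , atoms′ , p′ = graded m w′ w atoms′ atoms p′ p

  prod-++ : ∀ {w₁ U₁ m₁ w₂ U₂ m₂ U} (d : Decomp U₁ U₂ U) → Prod w₁ U₁ m₁ → Prod w₂ U₂ m₂ →
            Prod (w₁ ++ w₂) U (ν d m₁ m₂)
  prod-++ {w₂ = w₂} {U₂} {m₂} d prod-[] q with decomp-∅ˡ d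
  ... | refl = subst (Prod w₂ U₂) (sym (unitˡ d m₂)) q
  prod-++ d (prod-∷ d₁ p) q with reassocʳ d₁ d
  ... | _ , dBC , dT = subst (Prod _ _) (sym (assoc d₁ d dBC dT _ _ _)) (prod-∷ dT (prod-++ dBC p q))

  deg-ν : ∀ {U₁ U₂ U} (d : Decomp U₁ U₂ U) m₁ m₂ → deg (U , ν d m₁ m₂) ≡ deg (U₁ , m₁) + deg (U₂ , m₂)
  deg-ν {U₁} {U₂} d m₁ m₂ with generated U₁ m₁ | generated U₂ m₂
  ... | w₁ , atoms₁ , p₁ | w₂ , atoms₂ , p₂ = trans (deg-word (++⁺ atoms₁ atoms₂) (prod-++ d p₁ p₂)) (length-++ w₁)

  deg-zero : ∀ {W} (m : obj W) → deg (W , m) ≡ 0 → (W , m) ≡ 0̂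
  deg-zero {W} m d0 with generated W m
  deg-zero {W} m d0 | [] , _ , prod-[] = refl
  deg-zero {W} m () | _ ∷ _ , _ , _

  ν-unit : ∀ {U₁ W U₂} (d : Decomp U₁ W U₂) m₁ {m′ : obj W} → (W , m′) ≡ 0̂ → (U₁ , m₁) ≡ (U₂ , ν d m₁ m′)
  ν-unit d m₁ refl with decomp-∅ʳ d
  ... | refl = cong (_ ,_) (sym (unitʳ d m₁))

  ≤ν-refl : ∀ x → x ≤ν x
  ≤ν-refl (U , m) = ∅ , decomp-unit , e , unitʳ decomp-unit m

  ≤ν-trans : ∀ {x y z} → x ≤ν y → y ≤ν z → x ≤ν z
  ≤ν-trans {_ , m₁} (_ , d₁ , a , refl) (_ , d₂ , b , refl) with reassocʳ d₁ d₂
  ... | BC , dBC , dT = BC , dT , ν dBC a b , sym (assoc d₁ d₂ dBC dT m₁ a b)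

  0̂-least : ∀ x → 0̂ ≤ν x
  0̂-least (U , m) = U , decomp-swap decomp-unit , m , unitˡ (decomp-swap decomp-unit) m

  deg-0̂ : deg 0̂ ≡ 0
  deg-0̂ = deg-word [] prod-[]

  deg-mono : ∀ {x y} → x ≤ν y → deg x ≤ deg y
  deg-mono {_ , m₁} (_ , d , m′ , refl) = subst (_ ≤_) (sym (deg-ν d m₁ m′)) (m≤m+n _ _)

  deg-injective : ∀ {x y} → x ≤ν y → deg x ≡ deg y → x ≡ y
  deg-injective {x@(_ , m₁)} (W , d , m′ , refl) eq = ν-unit d m₁ (deg-zero m′ quotient-trivial)
    where
    quotient-trivial : deg (W , m′) ≡ 0
    quotient-trivial = +-cancelˡ-≡ (deg x) _ 0 (trans (sym (deg-ν d m₁ m′)) (trans (sym eq) (sym (+-identityʳ _))))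

  -- Peeling the first atom t off a quotient q = t · q′ of x ≤ν y gives an
  -- element ν(x, t) of degree deg x + 1 between x and y.
  peel-atom : ∀ {U₁ W U₂ w m′} (d : Decomp U₁ W U₂) m₁ → Atoms w → Prod w W m′ → 0 < length w →
              Σ Elt λ z → (U₁ , m₁) ≤ν z × z ≤ν (U₂ , ν d m₁ m′) × deg z ≡ suc (deg (U₁ , m₁))
  peel-atom d m₁ (atom ∷ _) (prod-∷ {a = t} {m′ = m″} d′ _) _ with reassocˡ d′ d
  ... | Z , dZ , dT = (Z , ν dZ m₁ t) , (_ , dZ , t , refl) , (_ , dT , m″ , assoc dZ dT d′ d m₁ t m″) ,
                      trans (deg-ν dZ m₁ t) (trans (cong (deg (_ , m₁) +_) deg-atom) (+-comm _ 1))
    where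
    deg-atom : deg (_ , t) ≡ 1
    deg-atom = deg-word (atom ∷ []) (subst (Prod _ _) (unitʳ decomp-unit t) (prod-∷ decomp-unit prod-[]))

  -- A degree jump forces a nonempty quotient word, whose first atom we peel.
  deg-step : ∀ {x y} → x ≤ν y → deg x < deg y → Σ Elt λ z → x ≤ν z × z ≤ν y × deg z ≡ suc (deg x)
  deg-step {x@(_ , m₁)} (W , d , m′ , refl) lt with generated W m′ | deg-ν d m₁ m′
  ... | w , atoms , p | additive = peel-atom d m₁ atoms p (≤∧≢⇒< z≤n nonempty)
    where
    nonempty : 0 ≢ length w
    nonempty empty = <-irrefl (sym (trans additive (trans (cong (deg x +_) (sym empty)) (+-identityʳ _)))) lt

  open RankedPreorder _≤ν_ deg ≤ν-refl ≤ν-trans deg-mono deg-injective deg-step public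

mainTheorem9 : ∀ {c ℓ : Level} (K : Field c ℓ) → HasCharZero K →
    (Q : QuadraticCMonoid K) →
    let open QuadraticCMonoid Q
        open CMonoid cmonoid
        open Quadratic.QuadraticStructure structure
        open Order cmonoid
    in ∀ (U : FinSet) (k : ℕ) (m : obj U) → HasDegree m k →
       GradedPoset.IsGradedOfRank _≤ν_ (InInterval U m) k
mainTheorem9 K _ Q U k m (w , atoms , len , p) =
  interval-graded 0̂ (U , m) (0̂-least (U , m)) k rank-gap
  where
  open QuadraticCMonoid Q
  open Order cmonoid
  open Degree K cmonoid structure
  rank-gap : deg 0̂ + k ≡ deg (U , m)
  rank-gap = trans (cong (_+ k) deg-0̂) (sym (trans (deg-word atoms p) len))
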